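{- Let $n\geq 6$ and let $(\mathbf{d},\mathbf{r})$ be an arithmetical structure on the cycle graph $\mathcal{C}_n$ such that $d_j\le n+1$ for all $j\in[n]$ and $d_i=n+1$ for some $i\in[n]$. Then there is an arithmetical structure $(\mathbf{d}^*,\mathbf{r}^*)$ on $\mathcal{C}_n$ such that $d_j+d_j^*\le n+2$ for all $j\in[n]$.
   Context: $\mathcal{C}_n$ is the cycle graph on vertices $v_1,\ldots,v_n$ with $v_i\sim v_{i+1}$ (indices mod $n$), and $A$ is its adjacency matrix. An arithmetical structure on $\mathcal{C}_n$ is a pair $(\mathbf{d},\mathbf{r})\in\mathbb{Z}^n_{>0}\times\mathbb{Z}^n_{>0}$ with $(\operatorname{diag}(\mathbf{d})-A)\mathbf{r}=\mathbf{0}$ and the entries of $\mathbf{r}$ having $\gcd$ $1$. -}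

module Defs where

open import Data.Nat using (ℕ; zero; suc; _+_; _*_; _≤_; _<_; NonZero)
open import Data.Nat.DivMod using (_%_; m%n<n)
open import Data.Nat.GCD using (gcd)
open import Data.Fin using (Fin; toℕ; fromℕ<)
open import Data.List using (List; foldr; map; allFin)
open import Data.Product using (_×_)
open import Relation.Binary.PropositionalEquality using (_≡_)

next : ∀ {n} → Fin (suc n) → Fin (suc n)
next {n} i = fromℕ< (m%n<n (suc (toℕ i)) (suc n))

prev : ∀ {n} → Fin (suc n) → Fin (suc n)
prev {n} i = fromℕ< (m%n<n (toℕ i + n) (suc n))

gcdAll : ∀ {m} → (Fin m → ℕ) → ℕ
gcdAll {m} r = foldr gcd 0 (map r (allFin m))

-- Arithmetical structure on C_{suc n} (intended for cycles of length ≥ 3, where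
-- (diag(d) - A) r = 0 reads  d_i r_i = r_{i-1} + r_{i+1}).
record IsArithStruct {n : ℕ} (d r : Fin (suc n) → ℕ) : Set where
  field
    d-pos : ∀ i → 0 < d i
    r-pos : ∀ i → 0 < r i
    kernel : ∀ i → d i * r i ≡ r (prev i) + r (next i)
    gcd-one : gcdAll r ≡ 1

module Submission where

-- Smoothing: deleting a vertex with d = 1 from a cycle and lowering the d of its two
-- neighbours by one leaves an arithmetical structure on the cycle one shorter; and if all
-- d_j ≥ 2, then Σ d_j r_j = 2 Σ r_j together with (d_j − 2)(r_j − 1) ≥ 0 gives Σ d ≤ 2n.
-- By induction Σ d ≤ 3n − 1 on every cycle of length n.  So if d_i = n + 1, the other n − 1
-- coefficients are positive with sum at most 2n − 2: each is at most n, and a neighbour of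
-- i is at most n − 1, because the two vertices beyond it cannot both have d = 1.  This is
-- exactly the room needed for d* = 1 at i, 3 at its neighbours and 2 elsewhere, which with
-- r* = 2 at i and 1 elsewhere is an arithmetical structure.

open import Defs
open import Data.Empty using (⊥-elim)
open import Data.Fin using (Fin; toℕ; fromℕ<) renaming (_≟_ to _≟ᶠ_)
open import Data.Fin.Properties using (toℕ<n; toℕ-fromℕ<; toℕ-injective; any?)
open import Data.List using (_∷_; foldr; map; allFin)
open import Data.List.Membership.Propositional using (_∈_)
open import Data.List.Membership.Propositional.Properties using (∈-allFin; ∈-map⁺)
open import Data.List.Relation.Unary.Any using (here; there)
open import Data.Nat using (ℕ; zero; suc; pred; _+_; _*_; _∸_; _≤_; _<_; z≤n; s≤s; s≤s⁻¹; _≟_; NonZero; >-nonZero)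
open import Data.Nat.DivMod using (_%_; m%n<n; %-distribˡ-+; m%n%n≡m%n; [m+n]%n≡m%n; m<n⇒m%n≡m)
open import Data.Nat.Divisibility using (_∣_; ∣-trans; ∣1⇒≡1)
open import Data.Nat.GCD using (gcd; gcd[m,n]∣m; gcd[m,n]∣n)
open import Data.Nat.Properties
open import Data.Nat.Tactic.RingSolver using (solve-∀)
open import Data.Product using (Σ; _×_; _,_; ∃)
open import Data.Sum using (inj₁; inj₂)
open import Function using (_∘′_; _⇔_; mk⇔; Equivalence)
open import Relation.Binary.PropositionalEquality
open import Relation.Nullary using (¬_; Dec; yes; no)
open import Relation.Nullary.Decidable using (toSum)

-- f 1 + … + f m: the value f 0 never enters.
sumTo : (ℕ → ℕ) → ℕ → ℕ
sumTo f zero    = 0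
sumTo f (suc m) = sumTo f m + f (suc m)

PositiveUpTo : ℕ → (ℕ → ℕ) → Set
PositiveUpTo m f = ∀ j → 1 ≤ j → j ≤ m → 0 < f j

sumTo-cong : ∀ {f g} m → (∀ j → 1 ≤ j → j ≤ m → f j ≡ g j) → sumTo f m ≡ sumTo g m
sumTo-cong zero    f≡g = refl
sumTo-cong (suc m) f≡g =
  cong₂ _+_ (sumTo-cong m λ j 1≤j j≤m → f≡g j 1≤j (m≤n⇒m≤1+n j≤m)) (f≡g (suc m) (s≤s z≤n) ≤-refl)

sumTo-mono-≤ : ∀ {f g} m → (∀ j → 1 ≤ j → j ≤ m → f j ≤ g j) → sumTo f m ≤ sumTo g m
sumTo-mono-≤ zero    f≤g = z≤n
sumTo-mono-≤ (suc m) f≤g =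
  +-mono-≤ (sumTo-mono-≤ m λ j 1≤j j≤m → f≤g j 1≤j (m≤n⇒m≤1+n j≤m)) (f≤g (suc m) (s≤s z≤n) ≤-refl)

sumTo-distrib-+ : ∀ f g m → sumTo (λ j → f j + g j) m ≡ sumTo f m + sumTo g m
sumTo-distrib-+ f g zero    = refl
sumTo-distrib-+ f g (suc m) = begin
  sumTo (λ j → f j + g j) m + (f (suc m) + g (suc m))
    ≡⟨ cong (_+ (f (suc m) + g (suc m))) (sumTo-distrib-+ f g m) ⟩
  sumTo f m + sumTo g m + (f (suc m) + g (suc m))
    ≡⟨ interchange (sumTo f m) (sumTo g m) (f (suc m)) (g (suc m)) ⟩
  sumTo f m + f (suc m) + (sumTo g m + g (suc m)) ∎
  where
  open ≡-Reasoning
  interchange : ∀ a b c d → a + b + (c + d) ≡ a + c + (b + d)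
  interchange = solve-∀

sumTo-const : ∀ c m → sumTo (λ _ → c) m ≡ m * c
sumTo-const c zero    = refl
sumTo-const c (suc m) = trans (cong (_+ c) (sumTo-const c m)) (+-comm (m * c) c)

sumTo-*ˡ : ∀ c f m → sumTo (λ j → c * f j) m ≡ c * sumTo f m
sumTo-*ˡ c f zero    = sym (*-zeroʳ c)
sumTo-*ˡ c f (suc m) =
  trans (cong (_+ c * f (suc m)) (sumTo-*ˡ c f m)) (sym (*-distribˡ-+ c (sumTo f m) (f (suc m))))

sumTo-suc : ∀ f m → sumTo f (suc m) ≡ f 1 + sumTo (λ j → f (suc j)) m
sumTo-suc f zero    = +-comm 0 (f 1)
sumTo-suc f (suc m) =
  trans (cong (_+ f (2 + m)) (sumTo-suc f m)) (+-assoc (f 1) (sumTo (λ j → f (suc j)) m) (f (2 + m)))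

sumTo-+ : ∀ f k m → sumTo f (k + m) ≡ sumTo f m + sumTo (λ j → f (j + m)) k
sumTo-+ f zero    m = sym (+-identityʳ (sumTo f m))
sumTo-+ f (suc k) m =
  trans (cong (_+ f (suc k + m)) (sumTo-+ f k m)) (+-assoc (sumTo f m) _ (f (suc k + m)))

length≤sumTo : ∀ {f} m → PositiveUpTo m f → m ≤ sumTo f m
length≤sumTo {f} m f>0 =
  subst (_≤ sumTo f m) (trans (sumTo-const 1 m) (*-identityʳ m)) (sumTo-mono-≤ m f>0)

block-sum≤ : ∀ {e} k w l → PositiveUpTo (l + (w + k)) e →
  sumTo e (l + (w + k)) ≤ 2 * (l + (w + k)) → sumTo (λ j → e (j + k)) w ≤ l + k + 2 * w
block-sum≤ {e} k w l e>0 sum≤ = +-cancelˡ-≤ (k + l) B (l + k + 2 * w) (begin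
  k + l + B                ≡⟨ rearrange k l B ⟩
  k + B + l                ≤⟨ +-mono-≤ (+-monoˡ-≤ B prefix≥) suffix≥ ⟩
  sumTo e k + B + T        ≡⟨ sym (trans (sumTo-+ e l (w + k)) (cong (_+ T) (sumTo-+ e w k))) ⟩
  sumTo e (l + (w + k))    ≤⟨ sum≤ ⟩
  2 * (l + (w + k))        ≡⟨ double k l w ⟩
  k + l + (l + k + 2 * w)  ∎)
  where
  open ≤-Reasoning
  B T : ℕ
  B = sumTo (λ j → e (j + k)) w
  T = sumTo (λ j → e (j + (w + k))) l
  prefix≥ : k ≤ sumTo e k
  prefix≥ = length≤sumTo k λ j 1≤j j≤k → e>0 j 1≤j (≤-trans j≤k (≤-trans (m≤n+m k w) (m≤n+m (w + k) l)))
  suffix≥ : l ≤ T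
  suffix≥ = length≤sumTo l λ j 1≤j j≤l → e>0 _ (≤-trans 1≤j (m≤m+n j _)) (+-monoˡ-≤ (w + k) j≤l)
  rearrange : ∀ k l b → k + l + b ≡ k + b + l
  rearrange = solve-∀
  double : ∀ k l w → 2 * (l + (w + k)) ≡ k + l + (l + k + 2 * w)
  double = solve-∀

-- The cycle of length suc L read along the positions 1 … suc L, position 0 standing
-- for position suc L; only x 0 … x (suc L) and e 1 … e (suc L) are constrained.
record IsCycleSolution (L : ℕ) (x e : ℕ → ℕ) : Set where
  field
    x-pos       : ∀ j → 0 < x j
    x-wrap      : x (suc L) ≡ x 0
    kernel      : ∀ k → k < L → e (suc k) * x (suc k) ≡ x k + x (suc (suc k))
    kernel-last : e (suc L) * x (suc L) ≡ x L + x 1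

open IsCycleSolution

*≡+⇒0< : ∀ p {v u w} → p * v ≡ u + w → 0 < u → 0 < p
*≡+⇒0< zero    {u = suc u} () _
*≡+⇒0< (suc p) _ _ = s≤s z≤n

e-pos : ∀ {L x e} → IsCycleSolution L x e → PositiveUpTo (suc L) e
e-pos {L} {x} {e} s (suc k) _ j≤ with m≤n⇒m<n∨m≡n (s≤s⁻¹ j≤)
... | inj₁ k<L = *≡+⇒0< (e (suc k)) (kernel s k k<L) (x-pos s k)
... | inj₂ refl = *≡+⇒0< (e (suc L)) (kernel-last s) (x-pos s L)

weighted-sum : ∀ {L x e} → IsCycleSolution L x e →
  sumTo (λ j → e j * x j) (suc L) ≡ 2 * sumTo x (suc L)
weighted-sum {L} {x} {e} s = begin
  sumTo (λ j → e j * x j) L + e (suc L) * x (suc L)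
    ≡⟨ cong₂ _+_ (sumTo-cong L λ { (suc k) _ k<L → kernel s k k<L }) (kernel-last s) ⟩
  sumTo (λ j → x (pred j) + x (suc j)) L + (x L + x 1)
    ≡⟨ cong (_+ (x L + x 1)) (sumTo-distrib-+ (λ j → x (pred j)) (λ j → x (suc j)) L) ⟩
  sumTo (λ j → x (pred j)) L + sumTo (λ j → x (suc j)) L + (x L + x 1)
    ≡⟨ regroup (sumTo (λ j → x (pred j)) L) (sumTo (λ j → x (suc j)) L) (x L) (x 1) ⟩
  sumTo (λ j → x (pred j)) (suc L) + (x 1 + sumTo (λ j → x (suc j)) L)
    ≡⟨ cong₂ _+_ (sumTo-suc (λ j → x (pred j)) L) (sym (sumTo-suc x L)) ⟩
  x 0 + sumTo x L + sumTo x (suc L)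
    ≡⟨ cong (λ z → z + sumTo x L + sumTo x (suc L)) (sym (x-wrap s)) ⟩
  x (suc L) + sumTo x L + sumTo x (suc L)
    ≡⟨ cong (_+ sumTo x (suc L)) (+-comm (x (suc L)) (sumTo x L)) ⟩
  sumTo x (suc L) + sumTo x (suc L)
    ≡⟨ sym (cong (sumTo x (suc L) +_) (+-identityʳ (sumTo x (suc L)))) ⟩
  2 * sumTo x (suc L) ∎
  where
  open ≡-Reasoning
  regroup : ∀ a b c d → a + b + (c + d) ≡ a + c + (d + b)
  regroup = solve-∀

-- (e - 2)(x - 1) ≥ 0
2*x+e≤e*x+2 : ∀ {e x} → 2 ≤ e → 1 ≤ x → 2 * x + e ≤ e * x + 2
2*x+e≤e*x+2 {suc zero} (s≤s ())
2*x+e≤e*x+2 {suc (suc a)} {suc b} _ _ =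
  subst (2 * suc b + suc (suc a) ≤_) (sym (expand a b)) (m≤m+n _ (a * b))
  where
  expand : ∀ a b → (2 + a) * (1 + b) + 2 ≡ 2 * (1 + b) + (2 + a) + a * b
  expand = solve-∀

sumTo≤2*length : ∀ {L x e} → IsCycleSolution L x e →
  (∀ j → 1 ≤ j → j ≤ suc L → 2 ≤ e j) → sumTo e (suc L) ≤ 2 * suc L
sumTo≤2*length {L} {x} {e} s e≥2 = +-cancelˡ-≤ (2 * S) (sumTo e N) (2 * N) (begin
  2 * S + sumTo e N
    ≡⟨ cong (_+ sumTo e N) (sym (sumTo-*ˡ 2 x N)) ⟩
  sumTo (λ j → 2 * x j) N + sumTo e N
    ≡⟨ sym (sumTo-distrib-+ (λ j → 2 * x j) e N) ⟩
  sumTo (λ j → 2 * x j + e j) N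
    ≤⟨ sumTo-mono-≤ N (λ j 1≤j j≤N → 2*x+e≤e*x+2 (e≥2 j 1≤j j≤N) (x-pos s j)) ⟩
  sumTo (λ j → e j * x j + 2) N
    ≡⟨ sumTo-distrib-+ (λ j → e j * x j) (λ _ → 2) N ⟩
  sumTo (λ j → e j * x j) N + sumTo (λ _ → 2) N
    ≡⟨ cong₂ _+_ (weighted-sum s) (trans (sumTo-const 2 N) (*-comm N 2)) ⟩
  2 * S + 2 * N ∎)
  where
  open ≤-Reasoning
  N S : ℕ
  N = suc L
  S = sumTo x N

rotate : ℕ → (ℕ → ℕ) → ℕ → ℕ
rotate L f j with j ≟ suc L
... | yes _ = f 1
... | no  _ = f (suc j)

rotate-last : ∀ L f → rotate L f (suc L) ≡ f 1
rotate-last L f with suc L ≟ suc L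
... | yes _   = refl
... | no  ≢sL = ⊥-elim (≢sL refl)

rotate-< : ∀ L f {j} → j < suc L → rotate L f j ≡ f (suc j)
rotate-< L f {j} j<sL with j ≟ suc L
... | yes j≡sL = ⊥-elim (<⇒≢ j<sL j≡sL)
... | no  _    = refl

rotate-solution : ∀ {M x e} → IsCycleSolution (suc M) x e →
  IsCycleSolution (suc M) (rotate (suc M) x) (rotate (suc M) e)
rotate-solution {M} {x} {e} s = record
  { x-pos       = λ j → rotate-pos j
  ; x-wrap      = trans (rotate-last L x) (sym (rotate-< L x (s≤s z≤n)))
  ; kernel      = kernel′
  ; kernel-last = kernel-last′
  }
  where
  L : ℕ
  L = suc M
  rotate-pos : ∀ j → 0 < rotate L x j
  rotate-pos j with j ≟ suc L
  ... | yes _ = x-pos s 1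
  ... | no  _ = x-pos s (suc j)
  kernel′ : ∀ k → k < L →
    rotate L e (suc k) * rotate L x (suc k) ≡ rotate L x k + rotate L x (suc (suc k))
  kernel′ k k<L rewrite rotate-< L e (s≤s k<L) | rotate-< L x (s≤s k<L) | rotate-< L x (m<n⇒m<1+n k<L)
    with m≤n⇒m<n∨m≡n k<L
  ... | inj₁ sk<L rewrite rotate-< L x (s≤s sk<L) = kernel s (suc k) sk<L
  ... | inj₂ refl rewrite rotate-last L x = kernel-last s
  kernel-last′ : rotate L e (suc L) * rotate L x (suc L) ≡ rotate L x L + rotate L x 1
  kernel-last′ rewrite rotate-last L e | rotate-last L x | rotate-< L x (≤-refl {suc L})
                     | rotate-< L x (s≤s (s≤s (z≤n {M}))) | x-wrap s = kernel s 0 (s≤s z≤n)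

sumTo-rotate : ∀ L e → sumTo (rotate L e) (suc L) ≡ sumTo e (suc L)
sumTo-rotate L e = begin
  sumTo (rotate L e) L + rotate L e (suc L)
    ≡⟨ cong₂ _+_ (sumTo-cong L λ j _ j≤L → rotate-< L e (s≤s j≤L)) (rotate-last L e) ⟩
  sumTo (λ j → e (suc j)) L + e 1
    ≡⟨ +-comm _ (e 1) ⟩
  e 1 + sumTo (λ j → e (suc j)) L
    ≡⟨ sym (sumTo-suc e L) ⟩
  sumTo e (suc L) ∎
  where open ≡-Reasoning

rotate-to-front : ∀ {M x e} t → IsCycleSolution (suc M) x e → t ≤ suc M → e (suc t) ≡ 1 →
  Σ (ℕ → ℕ) λ x′ → Σ (ℕ → ℕ) λ e′ →
    IsCycleSolution (suc M) x′ e′ × e′ 1 ≡ 1 × sumTo e′ (2 + M) ≡ sumTo e (2 + M)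
rotate-to-front {M} {x} {e} zero s _ e₁≡1 = x , e , s , e₁≡1 , refl
rotate-to-front {M} {x} {e} (suc t) s t<sM e≡1
  with rotate-to-front t (rotate-solution s) (<⇒≤ t<sM) (trans (rotate-< (suc M) e (s≤s t<sM)) e≡1)
... | x′ , e′ , s′ , e′₁≡1 , same = x′ , e′ , s′ , e′₁≡1 , trans same (sumTo-rotate (suc M) e)

δ : ℕ → ℕ → ℕ
δ zero    zero    = 1
δ zero    (suc _) = 0
δ (suc _) zero    = 0
δ (suc m) (suc n) = δ m n

δ-refl : ∀ m → δ m m ≡ 1
δ-refl zero    = refl
δ-refl (suc m) = δ-refl m

δ-≢ : ∀ {m n} → m ≢ n → δ m n ≡ 0
δ-≢ {zero}  {zero}  0≢0 = ⊥-elim (0≢0 refl)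
δ-≢ {zero}  {suc n} _   = refl
δ-≢ {suc m} {zero}  _   = refl
δ-≢ {suc m} {suc n} m≢n = δ-≢ (m≢n ∘′ cong suc)

sumTo-δ-< : ∀ {a} m → m < a → sumTo (λ k → δ k a) m ≡ 0
sumTo-δ-< zero    _    = refl
sumTo-δ-< (suc m) m<a = cong₂ _+_ (sumTo-δ-< m (<-trans (n<1+n m) m<a)) (δ-≢ (<⇒≢ m<a))

sumTo-δ : ∀ {a} m → 1 ≤ a → a ≤ m → sumTo (λ k → δ k a) m ≡ 1
sumTo-δ zero 1≤a a≤0 = ⊥-elim (<-irrefl refl (≤-trans 1≤a a≤0))
sumTo-δ (suc m) 1≤a a≤sm with m≤n⇒m<n∨m≡n a≤sm
... | inj₁ a<sm = cong₂ _+_ (sumTo-δ m 1≤a (s≤s⁻¹ a<sm)) (δ-≢ (>⇒≢ a<sm))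
... | inj₂ refl = cong₂ _+_ (sumTo-δ-< m ≤-refl) (δ-refl (suc m))

deleteFirst : (ℕ → ℕ) → ℕ → ℕ
deleteFirst x zero    = x zero
deleteFirst x (suc j) = x (suc (suc j))

-- Deleting a vertex with coefficient 1 from a cycle of length 2 + M: its two neighbours,
-- now at the positions 1 and suc M, lose one each (twice the same vertex when M = 0).
smooth : ℕ → (ℕ → ℕ) → ℕ → ℕ
smooth M e k = e (suc k) ∸ (δ k 1 + δ k (suc M))

*-∸-cancel : ∀ c e y z → e * y ≡ c * y + z → (e ∸ c) * y ≡ z
*-∸-cancel c e y z e*y≡ = begin
  (e ∸ c) * y      ≡⟨ *-distribʳ-∸ y e c ⟩
  e * y ∸ c * y    ≡⟨ cong (_∸ c * y) e*y≡ ⟩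
  c * y + z ∸ c * y ≡⟨ m+n∸m≡n (c * y) z ⟩
  z ∎
  where open ≡-Reasoning

smooth-solution : ∀ {M x e} → IsCycleSolution (suc M) x e → e 1 ≡ 1 →
  IsCycleSolution M (deleteFirst x) (smooth M e)
smooth-solution {M} {x} {e} s e₁≡1 = record
  { x-pos       = λ { zero → x-pos s 0 ; (suc j) → x-pos s (2 + j) }
  ; x-wrap      = x-wrap s
  ; kernel      = kernel′
  ; kernel-last = kernel-last′ M refl
  }
  where
  x₁≡ : x 1 ≡ x 0 + x 2
  x₁≡ = trans (sym (*-identityˡ (x 1))) (trans (cong (_* x 1) (sym e₁≡1)) (kernel s 0 (s≤s z≤n)))
  kernel′ : ∀ k → k < M →
    smooth M e (suc k) * deleteFirst x (suc k) ≡ deleteFirst x k + deleteFirst x (2 + k)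
  kernel′ zero    (s≤s z≤n) = *-∸-cancel 1 (e 2) (x 2) (x 0 + x 3) (begin
    e 2 * x 2       ≡⟨ kernel s 1 (s≤s (s≤s z≤n)) ⟩
    x 1 + x 3       ≡⟨ cong (_+ x 3) x₁≡ ⟩
    x 0 + x 2 + x 3 ≡⟨ shuffle (x 0) (x 2) (x 3) ⟩
    1 * x 2 + (x 0 + x 3) ∎)
    where
    open ≡-Reasoning
    shuffle : ∀ a y b → a + y + b ≡ 1 * y + (a + b)
    shuffle = solve-∀
  kernel′ (suc k) sk<M rewrite δ-≢ (<⇒≢ sk<M) = kernel s (2 + k) (s≤s sk<M)
  kernel-last′ : ∀ M′ → M′ ≡ M →
    smooth M e (suc M) * deleteFirst x (suc M) ≡ deleteFirst x M + deleteFirst x 1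
  kernel-last′ zero refl = *-∸-cancel 2 (e 2) (x 2) (x 0 + x 2) (begin
    e 2 * x 2                   ≡⟨ kernel-last s ⟩
    x 1 + x 1                   ≡⟨ cong₂ _+_ x₁≡ x₁≡ ⟩
    x 0 + x 2 + (x 0 + x 2)     ≡⟨ cong (λ z → z + x 2 + (x 0 + x 2)) (sym (x-wrap s)) ⟩
    x 2 + x 2 + (x 0 + x 2)     ≡⟨ cong (_+ (x 0 + x 2)) (cong (x 2 +_) (sym (+-identityʳ (x 2)))) ⟩
    2 * x 2 + (x 0 + x 2) ∎)
    where open ≡-Reasoning
  kernel-last′ (suc M′) refl rewrite δ-refl M′ =
    *-∸-cancel 1 (e (3 + M′)) (x (3 + M′)) (x (2 + M′) + x 2) (begin
    e (3 + M′) * x (3 + M′)            ≡⟨ kernel-last s ⟩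
    x (2 + M′) + x 1                   ≡⟨ cong (x (2 + M′) +_) x₁≡ ⟩
    x (2 + M′) + (x 0 + x 2)           ≡⟨ cong (λ z → x (2 + M′) + (z + x 2)) (sym (x-wrap s)) ⟩
    x (2 + M′) + (x (3 + M′) + x 2)    ≡⟨ shuffle (x (2 + M′)) (x (3 + M′)) (x 2) ⟩
    1 * x (3 + M′) + (x (2 + M′) + x 2) ∎)
    where
    open ≡-Reasoning
    shuffle : ∀ a y b → a + (y + b) ≡ 1 * y + (a + b)
    shuffle = solve-∀

sumTo-smooth : ∀ M e → e 1 ≡ 1 → sumTo e (2 + M) ≤ sumTo (smooth M e) (suc M) + 3
sumTo-smooth M e e₁≡1 = begin
  sumTo e (2 + M)
    ≡⟨ sumTo-suc e (suc M) ⟩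
  e 1 + sumTo (λ k → e (suc k)) (suc M)
    ≤⟨ +-mono-≤ (≤-reflexive e₁≡1) (sumTo-mono-≤ (suc M) λ k _ _ → e≤smooth+loss k) ⟩
  1 + sumTo (λ k → smooth M e k + (δ k 1 + δ k (suc M))) (suc M)
    ≡⟨ cong (1 +_) (trans (sumTo-distrib-+ (smooth M e) loss (suc M))
                          (cong (sumTo (smooth M e) (suc M) +_) loss-total)) ⟩
  1 + (sumTo (smooth M e) (suc M) + 2)
    ≡⟨ regroup (sumTo (smooth M e) (suc M)) ⟩
  sumTo (smooth M e) (suc M) + 3 ∎
  where
  open ≤-Reasoning
  loss : ℕ → ℕ
  loss k = δ k 1 + δ k (suc M)
  e≤smooth+loss : ∀ k → e (suc k) ≤ smooth M e k + loss k
  e≤smooth+loss k = subst (e (suc k) ≤_) (+-comm (loss k) _) (m≤n+m∸n (e (suc k)) (loss k))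
  loss-total : sumTo loss (suc M) ≡ 2
  loss-total = trans (sumTo-distrib-+ (λ k → δ k 1) (λ k → δ k (suc M)) (suc M))
                     (cong₂ _+_ (sumTo-δ (suc M) ≤-refl (s≤s z≤n)) (sumTo-δ (suc M) (s≤s z≤n) ≤-refl))
  regroup : ∀ s → 1 + (s + 2) ≡ s + 3
  regroup = solve-∀

sumTo<3*length : ∀ {L x e} → IsCycleSolution L x e → sumTo e (suc L) < 3 * suc L
sumTo<3*length {zero} {x} {e} s = ≤-reflexive (cong suc e₁≡2)
  where
  instance _ = >-nonZero (x-pos s 1)
  e₁≡2 : e 1 ≡ 2
  e₁≡2 = *-cancelʳ-≡ (e 1) 2 (x 1) (begin
    e 1 * x 1   ≡⟨ kernel-last s ⟩
    x 0 + x 1   ≡⟨ cong (_+ x 1) (sym (x-wrap s)) ⟩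
    x 1 + x 1   ≡⟨ cong (x 1 +_) (sym (+-identityʳ (x 1))) ⟩
    2 * x 1     ∎)
    where open ≡-Reasoning
sumTo<3*length {suc M} {x} {e} s with any? (λ (t : Fin (2 + M)) → e (suc (toℕ t)) ≟ 1)
... | yes (t , e≡1) with rotate-to-front (toℕ t) s (s≤s⁻¹ (toℕ<n t)) e≡1
...   | x′ , e′ , s′ , e′₁≡1 , same = begin-strict
  sumTo e (2 + M)                     ≡⟨ sym same ⟩
  sumTo e′ (2 + M)                    ≤⟨ sumTo-smooth M e′ e′₁≡1 ⟩
  sumTo (smooth M e′) (suc M) + 3     <⟨ +-monoˡ-< 3 (sumTo<3*length (smooth-solution s′ e′₁≡1)) ⟩
  3 * suc M + 3                       ≡⟨ +-comm (3 * suc M) 3 ⟩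
  3 + 3 * suc M                       ≡⟨ sym (*-suc 3 (suc M)) ⟩
  3 * (2 + M) ∎
  where open ≤-Reasoning
sumTo<3*length {suc M} {x} {e} s | no no-ones = begin-strict
  sumTo e (2 + M) ≤⟨ sumTo≤2*length s e≥2 ⟩
  2 * (2 + M)     <⟨ *-monoˡ-< (2 + M) (≤-refl {3}) ⟩
  3 * (2 + M) ∎
  where
  open ≤-Reasoning
  e≥2 : ∀ j → 1 ≤ j → j ≤ 2 + M → 2 ≤ e j
  e≥2 (suc k) 1≤j j≤ with e (suc k) in eq | e-pos s (suc k) 1≤j j≤
  ... | suc zero    | _ = ⊥-elim (no-ones (fromℕ< j≤ , trans (cong (λ i → e (suc i)) (toℕ-fromℕ< j≤)) eq))
  ... | suc (suc _) | _ = s≤s (s≤s z≤n)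

-- Two consecutive coefficients 1 would give x (suc a) = x a + x (suc a) + x (3 + a).
3≤adjacent-sum : ∀ {L x e} a → IsCycleSolution L x e → suc a < L → 3 ≤ e (suc a) + e (2 + a)
3≤adjacent-sum {L} {x} {e} a s sa<L = go (e (suc a)) (e (2 + a))
  (*≡+⇒0< _ kernelᵃ (x-pos s a)) (*≡+⇒0< _ kernelᵇ (x-pos s (suc a))) kernelᵃ kernelᵇ
  where
  kernelᵃ : e (suc a) * x (suc a) ≡ x a + x (2 + a)
  kernelᵃ = kernel s a (<-trans (n<1+n a) sa<L)
  kernelᵇ : e (2 + a) * x (2 + a) ≡ x (suc a) + x (3 + a)
  kernelᵇ = kernel s (suc a) sa<L
  go : ∀ p q → 0 < p → 0 < q →
       p * x (suc a) ≡ x a + x (2 + a) → q * x (2 + a) ≡ x (suc a) + x (3 + a) → 3 ≤ p + q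
  go (suc zero) (suc zero) _ _ p≡ q≡ =
    ⊥-elim (<-irrefl loop (m<n+m (x (suc a)) (<-≤-trans (x-pos s a) (m≤m+n _ _))))
    where
    open ≡-Reasoning
    loop : x (suc a) ≡ x a + x (3 + a) + x (suc a)
    loop = begin
      x (suc a)                          ≡⟨ sym (*-identityˡ (x (suc a))) ⟩
      1 * x (suc a)                      ≡⟨ p≡ ⟩
      x a + x (2 + a)                    ≡⟨ cong (x a +_) (trans (sym (*-identityˡ (x (2 + a)))) q≡) ⟩
      x a + (x (suc a) + x (3 + a))      ≡⟨ rearrange (x a) (x (suc a)) (x (3 + a)) ⟩
      x a + x (3 + a) + x (suc a) ∎
      where
      rearrange : ∀ u v z → u + (v + z) ≡ u + z + v
      rearrange = solve-∀
  go (suc zero)    (suc (suc q)) _ _ _ _ = s≤s (s≤s (s≤s z≤n))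
  go (suc (suc p)) (suc q)       _ _ _ _ = s≤s (s≤s (subst (1 ≤_) (sym (+-suc p q)) (s≤s z≤n)))

sumTo-light≤ : ∀ {n x e} → IsCycleSolution n x e → suc n + 1 ≤ e (suc n) → sumTo e n ≤ 2 * n
sumTo-light≤ {n} {x} {e} s heavy = +-cancelʳ-≤ (suc n + 1) (sumTo e n) (2 * n) (s≤s⁻¹ (begin-strict
  sumTo e n + (suc n + 1)       ≤⟨ +-monoʳ-≤ (sumTo e n) heavy ⟩
  sumTo e n + e (suc n)         <⟨ sumTo<3*length s ⟩
  3 * suc n                     ≡⟨ split n ⟩
  suc (2 * n + (suc n + 1))     ∎))
  where
  open ≤-Reasoning
  split : ∀ n → 3 * suc n ≡ suc (2 * n + (suc n + 1))
  split = solve-∀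

module _ {e : ℕ → ℕ} where

  term≤ : ∀ n → PositiveUpTo n e → sumTo e n ≤ 2 * n →
    ∀ k → 1 ≤ k → k ≤ n → e k ≤ suc n
  term≤ n e>0 sum≤ (suc k) _ k<n = subst (λ m → e (suc k) ≤ suc m) n≡ (≤-trans
    (block-sum≤ k 1 l (subst (λ m → PositiveUpTo m e) (sym n≡) e>0)
                      (subst (λ m → sumTo e m ≤ 2 * m) (sym n≡) sum≤))
    (≤-reflexive (regroup l k)))
    where
    l : ℕ
    l = n ∸ suc k
    n≡ : l + suc k ≡ n
    n≡ = m∸n+n≡m k<n
    regroup : ∀ l k → l + k + 2 ≡ suc (l + suc k)
    regroup = solve-∀

  private
    pair+single≤ : ∀ {s a m} → s + a ≤ m + 6 → 3 ≤ s → a ≤ 3 + m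
    pair+single≤ {s} {a} {m} sum≤ 3≤s = +-cancelˡ-≤ 3 a (3 + m) (begin
      3 + a ≤⟨ +-monoˡ-≤ a 3≤s ⟩
      s + a ≤⟨ sum≤ ⟩
      m + 6 ≡⟨ +-comm m 6 ⟩
      3 + (3 + m) ∎)
      where open ≤-Reasoning

  first≤ : ∀ q → PositiveUpTo (3 + q) e → sumTo e (3 + q) ≤ 2 * (3 + q) →
    3 ≤ e 2 + e 3 → e 1 ≤ 3 + q
  first≤ q e>0 sum≤ 3≤pair = pair+single≤ (begin
    e 2 + e 3 + e 1 ≡⟨ rotate3 (e 1) (e 2) (e 3) ⟩
    e 1 + e 2 + e 3 ≤⟨ block-sum≤ 0 3 q (subst (λ m → PositiveUpTo m e) (+-comm 3 q) e>0)
                                        (subst (λ m → sumTo e m ≤ 2 * m) (+-comm 3 q) sum≤) ⟩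
    q + 0 + 6       ≡⟨ cong (_+ 6) (+-identityʳ q) ⟩
    q + 6 ∎) 3≤pair
    where
    open ≤-Reasoning
    rotate3 : ∀ a b c → b + c + a ≡ a + b + c
    rotate3 = solve-∀

  last≤ : ∀ q → PositiveUpTo (3 + q) e → sumTo e (3 + q) ≤ 2 * (3 + q) →
    3 ≤ e (1 + q) + e (2 + q) → e (3 + q) ≤ 3 + q
  last≤ q e>0 sum≤ 3≤pair = pair+single≤ (block-sum≤ q 3 0 e>0 sum≤) 3≤pair

[m%d+n]%d≡[m+n]%d : ∀ m n d .{{_ : NonZero d}} → (m % d + n) % d ≡ (m + n) % d
[m%d+n]%d≡[m+n]%d m n d = begin
  (m % d + n) % d         ≡⟨ %-distribˡ-+ (m % d) n d ⟩
  (m % d % d + n % d) % d ≡⟨ cong (λ z → (z + n % d) % d) (m%n%n≡m%n m d) ⟩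
  (m % d + n % d) % d     ≡⟨ sym (%-distribˡ-+ m n d) ⟩
  (m + n) % d ∎
  where open ≡-Reasoning

[m+n%d]%d≡[m+n]%d : ∀ m n d .{{_ : NonZero d}} → (m + n % d) % d ≡ (m + n) % d
[m+n%d]%d≡[m+n]%d m n d = begin
  (m + n % d) % d ≡⟨ cong (_% d) (+-comm m (n % d)) ⟩
  (n % d + m) % d ≡⟨ [m%d+n]%d≡[m+n]%d n m d ⟩
  (n + m) % d     ≡⟨ cong (_% d) (+-comm n m) ⟩
  (m + n) % d ∎
  where open ≡-Reasoning

module _ {n : ℕ} where

  shift : Fin (suc n) → ℕ → Fin (suc n)
  shift i zero    = i
  shift i (suc k) = next (shift i k)

  toℕ-next : ∀ t → toℕ (next t) ≡ suc (toℕ t) % suc n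
  toℕ-next t = toℕ-fromℕ< (m%n<n (suc (toℕ t)) (suc n))

  toℕ-prev : ∀ t → toℕ (prev t) ≡ (toℕ t + n) % suc n
  toℕ-prev t = toℕ-fromℕ< (m%n<n (toℕ t + n) (suc n))

  [t+N]%N≡t : ∀ t → (toℕ t + suc n) % suc n ≡ toℕ t
  [t+N]%N≡t t = trans ([m+n]%n≡m%n (toℕ t) (suc n)) (m<n⇒m%n≡m (toℕ<n t))

  toℕ-shift : ∀ i k → toℕ (shift i k) ≡ (toℕ i + k) % suc n
  toℕ-shift i zero    = sym (trans (cong (_% suc n) (+-identityʳ (toℕ i))) (m<n⇒m%n≡m (toℕ<n i)))
  toℕ-shift i (suc k) = begin
    toℕ (next (shift i k))         ≡⟨ toℕ-next (shift i k) ⟩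
    suc (toℕ (shift i k)) % suc n  ≡⟨ cong (λ m → suc m % suc n) (toℕ-shift i k) ⟩
    (1 + (toℕ i + k) % suc n) % suc n ≡⟨ [m+n%d]%d≡[m+n]%d 1 (toℕ i + k) (suc n) ⟩
    suc (toℕ i + k) % suc n        ≡⟨ cong (_% suc n) (sym (+-suc (toℕ i) k)) ⟩
    (toℕ i + suc k) % suc n ∎
    where open ≡-Reasoning

  prev-next : ∀ t → prev (next t) ≡ t
  prev-next t = toℕ-injective (begin
    toℕ (prev (next t))          ≡⟨ toℕ-prev (next t) ⟩
    (toℕ (next t) + n) % suc n   ≡⟨ cong (λ m → (m + n) % suc n) (toℕ-next t) ⟩
    (suc (toℕ t) % suc n + n) % suc n ≡⟨ [m%d+n]%d≡[m+n]%d (suc (toℕ t)) n (suc n) ⟩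
    (suc (toℕ t) + n) % suc n    ≡⟨ cong (_% suc n) (sym (+-suc (toℕ t) n)) ⟩
    (toℕ t + suc n) % suc n      ≡⟨ [t+N]%N≡t t ⟩
    toℕ t ∎)
    where open ≡-Reasoning

  next-prev : ∀ t → next (prev t) ≡ t
  next-prev t = toℕ-injective (begin
    toℕ (next (prev t))                 ≡⟨ toℕ-next (prev t) ⟩
    suc (toℕ (prev t)) % suc n          ≡⟨ cong (λ m → suc m % suc n) (toℕ-prev t) ⟩
    (1 + (toℕ t + n) % suc n) % suc n   ≡⟨ [m+n%d]%d≡[m+n]%d 1 (toℕ t + n) (suc n) ⟩
    suc (toℕ t + n) % suc n             ≡⟨ cong (_% suc n) (sym (+-suc (toℕ t) n)) ⟩
    (toℕ t + suc n) % suc n             ≡⟨ [t+N]%N≡t t ⟩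
    toℕ t ∎)
    where open ≡-Reasoning

  prev≡⇔≡next : ∀ {t s} → prev t ≡ s ⇔ t ≡ next s
  prev≡⇔≡next {t} {s} =
    mk⇔ (λ eq → trans (sym (next-prev t)) (cong next eq)) (λ eq → trans (cong prev eq) (prev-next s))

  next≡⇔≡prev : ∀ {t s} → next t ≡ s ⇔ t ≡ prev s
  next≡⇔≡prev {t} {s} =
    mk⇔ (λ eq → trans (sym (prev-next t)) (cong prev eq)) (λ eq → trans (cong next eq) (next-prev s))

  shift-period : ∀ i → shift i (suc n) ≡ i
  shift-period i = toℕ-injective (trans (toℕ-shift i (suc n)) ([t+N]%N≡t i))

  prev≡shift : ∀ i → prev i ≡ shift i n
  prev≡shift i = toℕ-injective (trans (toℕ-prev i) (sym (toℕ-shift i n)))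

  module _ (i : Fin (suc n)) where
    private
      unshift : ℕ → ℕ
      unshift m = (m + (suc n ∸ toℕ i)) % suc n

      i+[N∸i]≡N : toℕ i + (suc n ∸ toℕ i) ≡ suc n
      i+[N∸i]≡N = m+[n∸m]≡n (<⇒≤ (toℕ<n i))

      unshift-shift : ∀ {a} → a ≤ n → unshift (toℕ (shift i a)) ≡ a
      unshift-shift {a} a≤n = begin
        (toℕ (shift i a) + (suc n ∸ toℕ i)) % suc n      ≡⟨ cong (λ m → (m + (suc n ∸ toℕ i)) % suc n) (toℕ-shift i a) ⟩
        ((toℕ i + a) % suc n + (suc n ∸ toℕ i)) % suc n  ≡⟨ [m%d+n]%d≡[m+n]%d (toℕ i + a) _ (suc n) ⟩
        (toℕ i + a + (suc n ∸ toℕ i)) % suc n            ≡⟨ cong (_% suc n) (regroup (toℕ i) a _) ⟩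
        (a + (toℕ i + (suc n ∸ toℕ i))) % suc n          ≡⟨ cong (λ m → (a + m) % suc n) i+[N∸i]≡N ⟩
        (a + suc n) % suc n                              ≡⟨ [m+n]%n≡m%n a (suc n) ⟩
        a % suc n                                        ≡⟨ m<n⇒m%n≡m (s≤s a≤n) ⟩
        a ∎
        where
        open ≡-Reasoning
        regroup : ∀ i a c → i + a + c ≡ a + (i + c)
        regroup = solve-∀

    shift-injective : ∀ {a b} → a ≤ n → b ≤ n → shift i a ≡ shift i b → a ≡ b
    shift-injective {a} {b} a≤n b≤n eq =
      trans (sym (unshift-shift a≤n)) (trans (cong (λ t → unshift (toℕ t)) eq) (unshift-shift b≤n))

    shift-surjective : ∀ t → ∃ λ k → k ≤ n × shift i k ≡ t
    shift-surjective t = k , s≤s⁻¹ (m%n<n (toℕ t + (suc n ∸ toℕ i)) (suc n)) , toℕ-injective (begin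
      toℕ (shift i k)                              ≡⟨ toℕ-shift i k ⟩
      (toℕ i + k) % suc n                          ≡⟨ [m+n%d]%d≡[m+n]%d (toℕ i) _ (suc n) ⟩
      (toℕ i + (toℕ t + (suc n ∸ toℕ i))) % suc n  ≡⟨ cong (_% suc n) (regroup (toℕ i) (toℕ t) _) ⟩
      (toℕ t + (toℕ i + (suc n ∸ toℕ i))) % suc n  ≡⟨ cong (λ m → (toℕ t + m) % suc n) i+[N∸i]≡N ⟩
      (toℕ t + suc n) % suc n                      ≡⟨ [t+N]%N≡t t ⟩
      toℕ t ∎)
      where
      open ≡-Reasoning
      k : ℕ
      k = unshift (toℕ t)
      regroup : ∀ i t c → i + (t + c) ≡ t + (i + c)
      regroup = solve-∀

arithStruct⇒cycleSolution : ∀ {n d r} → IsArithStruct {n} d r → ∀ i →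
  IsCycleSolution n (λ k → r (shift i k)) (λ k → d (shift i k))
arithStruct⇒cycleSolution {n} {d} {r} A i = record
  { x-pos       = λ k → r-pos (shift i k)
  ; x-wrap      = cong r (shift-period i)
  ; kernel      = λ k _ → trans (kernelᴬ (shift i (suc k)))
                                (cong (λ t → r t + r (shift i (2 + k))) (prev-next (shift i k)))
  ; kernel-last = trans (kernelᴬ (shift i (suc n)))
                        (cong₂ (λ t u → r t + r u) (prev-next (shift i n)) (cong next (shift-period i)))
  }
  where open IsArithStruct A renaming (kernel to kernelᴬ)

heavy-vertex-bounds : ∀ {n} {d r : Fin (suc n) → ℕ} → 3 ≤ n → IsArithStruct d r →
  ∀ i → d i ≡ suc n + 1 → d (next i) ≤ n × d (prev i) ≤ n × (∀ t → t ≢ i → d t ≤ suc n)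
heavy-vertex-bounds {n@(suc (suc (suc q)))} {d} {r} (s≤s (s≤s (s≤s _))) A i heavy =
  next≤ , prev≤ , other≤
  where
  open IsArithStruct A using (d-pos)
  e : ℕ → ℕ
  e k = d (shift i k)
  s : IsCycleSolution n (λ k → r (shift i k)) e
  s = arithStruct⇒cycleSolution A i
  e>0 : PositiveUpTo n e
  e>0 j _ _ = d-pos (shift i j)
  sum≤ : sumTo e n ≤ 2 * n
  sum≤ = sumTo-light≤ s (≤-reflexive (sym (trans (cong d (shift-period i)) heavy)))
  next≤ : d (next i) ≤ n
  next≤ = first≤ q e>0 sum≤ (3≤adjacent-sum 1 s (s≤s (s≤s (s≤s z≤n))))
  prev≤ : d (prev i) ≤ n
  prev≤ = subst (_≤ n) (cong d (sym (prev≡shift i)))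
                (last≤ q e>0 sum≤ (3≤adjacent-sum q s (s≤s (s≤s (n≤1+n q)))))
  other≤ : ∀ t → t ≢ i → d t ≤ suc n
  other≤ t t≢i with shift-surjective i t
  ... | zero  , _   , refl = ⊥-elim (t≢i refl)
  ... | suc k , k<n , refl = term≤ n e>0 sum≤ (suc k) (s≤s z≤n) k<n

𝟙 : {P : Set} → Dec P → ℕ
𝟙 (yes _) = 1
𝟙 (no  _) = 0

𝟙-yes : {P : Set} (P? : Dec P) → P → 𝟙 P? ≡ 1
𝟙-yes (yes _) _ = refl
𝟙-yes (no ¬p) p = ⊥-elim (¬p p)

𝟙-no : {P : Set} (P? : Dec P) → ¬ P → 𝟙 P? ≡ 0
𝟙-no (yes p) ¬p = ⊥-elim (¬p p)
𝟙-no (no  _) _  = refl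

𝟙-⇔ : {P Q : Set} → P ⇔ Q → (P? : Dec P) (Q? : Dec Q) → 𝟙 P? ≡ 𝟙 Q?
𝟙-⇔ P⇔Q P? (yes q) = 𝟙-yes P? (Equivalence.from P⇔Q q)
𝟙-⇔ P⇔Q P? (no ¬q) = 𝟙-no P? (¬q ∘′ Equivalence.to P⇔Q)

foldr-gcd∣ : ∀ xs {y} → y ∈ xs → foldr gcd 0 xs ∣ y
foldr-gcd∣ (x ∷ xs) (here refl) = gcd[m,n]∣m x (foldr gcd 0 xs)
foldr-gcd∣ (x ∷ xs) (there y∈xs) = ∣-trans (gcd[m,n]∣n x (foldr gcd 0 xs)) (foldr-gcd∣ xs y∈xs)

gcdAll∣ : ∀ {m} (r : Fin m → ℕ) t → gcdAll r ∣ r t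
gcdAll∣ r t = foldr-gcd∣ (map r (allFin _)) (∈-map⁺ r (∈-allFin t))

module _ {n : ℕ} (i : Fin (suc n)) where

  next≢self : 1 ≤ n → next i ≢ i
  next≢self 1≤n eq = 1+n≢0 (shift-injective i 1≤n z≤n eq)

  prev≢self : 1 ≤ n → prev i ≢ i
  prev≢self 1≤n eq = <⇒≢ 1≤n (sym (shift-injective i ≤-refl z≤n (trans (sym (prev≡shift i)) eq)))

  next≢prev : 2 ≤ n → next i ≢ prev i
  next≢prev 2≤n eq = <⇒≢ 2≤n (shift-injective i (≤-trans (s≤s z≤n) 2≤n) ≤-refl (trans eq (prev≡shift i)))

  r⋆ : Fin (suc n) → ℕ
  r⋆ t = 1 + 𝟙 (t ≟ᶠ i)

  d⋆ : Fin (suc n) → ℕ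
  d⋆ t with t ≟ᶠ i
  ... | yes _ = 1
  ... | no  _ = 2 + 𝟙 (t ≟ᶠ next i) + 𝟙 (t ≟ᶠ prev i)

  d⋆-self : d⋆ i ≡ 1
  d⋆-self with i ≟ᶠ i
  ... | yes _ = refl
  ... | no i≢i = ⊥-elim (i≢i refl)

  d⋆-other : ∀ {t} → t ≢ i → d⋆ t ≡ 2 + 𝟙 (t ≟ᶠ next i) + 𝟙 (t ≟ᶠ prev i)
  d⋆-other {t} t≢i with t ≟ᶠ i
  ... | yes t≡i = ⊥-elim (t≢i t≡i)
  ... | no  _   = refl

  r⋆-neighbours : ∀ t → r⋆ (prev t) + r⋆ (next t) ≡ 2 + 𝟙 (t ≟ᶠ next i) + 𝟙 (t ≟ᶠ prev i)
  r⋆-neighbours t = trans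
    (cong₂ (λ a b → 1 + a + (1 + b)) (𝟙-⇔ prev≡⇔≡next (prev t ≟ᶠ i) (t ≟ᶠ next i))
                                     (𝟙-⇔ next≡⇔≡prev (next t ≟ᶠ i) (t ≟ᶠ prev i)))
    (regroup (𝟙 (t ≟ᶠ next i)) (𝟙 (t ≟ᶠ prev i)))
    where
    regroup : ∀ a b → 1 + a + (1 + b) ≡ 2 + a + b
    regroup = solve-∀

  isArithStruct⋆ : 1 ≤ n → IsArithStruct d⋆ r⋆
  isArithStruct⋆ 1≤n = record
    { d-pos   = d⋆-pos
    ; r-pos   = λ _ → s≤s z≤n
    ; kernel  = kernel⋆
    ; gcd-one = ∣1⇒≡1 (subst (gcdAll r⋆ ∣_) (cong suc (𝟙-no (next i ≟ᶠ i) (next≢self 1≤n)))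
                                           (gcdAll∣ r⋆ (next i)))
    }
    where
    d⋆-pos : ∀ t → 0 < d⋆ t
    d⋆-pos t with t ≟ᶠ i
    ... | yes _ = s≤s z≤n
    ... | no  _ = s≤s z≤n
    kernel⋆ : ∀ t → d⋆ t * r⋆ t ≡ r⋆ (prev t) + r⋆ (next t)
    kernel⋆ t with toSum (t ≟ᶠ i)
    ... | inj₁ refl = begin
      d⋆ i * r⋆ i          ≡⟨ cong₂ (λ a b → a * suc b) d⋆-self (𝟙-yes (i ≟ᶠ i) refl) ⟩
      2                    ≡⟨ cong₂ (λ a b → 2 + a + b) (𝟙-no (i ≟ᶠ next i) (next≢self 1≤n ∘′ sym))
                                                         (𝟙-no (i ≟ᶠ prev i) (prev≢self 1≤n ∘′ sym)) ⟨
      2 + 𝟙 (i ≟ᶠ next i) + 𝟙 (i ≟ᶠ prev i) ≡⟨ r⋆-neighbours i ⟨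
      r⋆ (prev i) + r⋆ (next i) ∎
      where open ≡-Reasoning
    ... | inj₂ t≢i = begin
      d⋆ t * r⋆ t          ≡⟨ cong (λ b → d⋆ t * suc b) (𝟙-no (t ≟ᶠ i) t≢i) ⟩
      d⋆ t * 1             ≡⟨ *-identityʳ (d⋆ t) ⟩
      d⋆ t                 ≡⟨ d⋆-other t≢i ⟩
      2 + 𝟙 (t ≟ᶠ next i) + 𝟙 (t ≟ᶠ prev i) ≡⟨ r⋆-neighbours t ⟨
      r⋆ (prev t) + r⋆ (next t) ∎
      where open ≡-Reasoning

  +d⋆≤ : ∀ {d : Fin (suc n) → ℕ} → 2 ≤ n → d i ≡ suc n + 1 →
    d (next i) ≤ n × d (prev i) ≤ n × (∀ t → t ≢ i → d t ≤ suc n) → ∀ t → d t + d⋆ t ≤ suc n + 2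
  +d⋆≤ {d} 2≤n heavy (next≤ , prev≤ , other≤) t with toSum (t ≟ᶠ i)
  ... | inj₁ refl = ≤-reflexive (trans (cong₂ _+_ heavy d⋆-self) (+-assoc (suc n) 1 1))
  ... | inj₂ t≢i rewrite d⋆-other t≢i with t ≟ᶠ next i | t ≟ᶠ prev i
  ...   | yes refl | yes t≡prev = ⊥-elim (next≢prev 2≤n t≡prev)
  ...   | yes refl | no  _      = ≤-trans (+-monoˡ-≤ 3 next≤) (≤-reflexive (+-suc n 2))
  ...   | no  _    | yes refl   = ≤-trans (+-monoˡ-≤ 3 prev≤) (≤-reflexive (+-suc n 2))
  ...   | no  _    | no  _      = +-monoˡ-≤ 2 (other≤ t t≢i)

lemma4p2 : (n : ℕ) → 6 ≤ suc n → (d r : Fin (suc n) → ℕ) → IsArithStruct d r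
    → (∀ j → d j ≤ suc n + 1) → (∃ λ i → d i ≡ suc n + 1)
    → Σ (Fin (suc n) → ℕ) λ d* → Σ (Fin (suc n) → ℕ) λ r* →
        IsArithStruct d* r* × (∀ j → d j + d* j ≤ suc n + 2)
lemma4p2 n 6≤N d r A _ (i , heavy) =
  d⋆ i , r⋆ i , isArithStruct⋆ i (≤-trans (s≤s z≤n) 3≤n) ,
  +d⋆≤ i (≤-trans (s≤s (s≤s z≤n)) 3≤n) heavy (heavy-vertex-bounds 3≤n A i heavy)
  where
  3≤n : 3 ≤ n
  3≤n = ≤-trans (s≤s (s≤s (s≤s z≤n))) (s≤s⁻¹ 6≤N)
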